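{- Any edge-to-edge tiling of the sphere by quadrilaterals in which every vertex has degree at least $3$ has a tile whose four vertices have degrees (as a multiset) $\{3,3,3,d\}$ with $d\ge 3$, or $\{3,3,4,d\}$ with $4\le d\le 11$, or $\{3,3,5,d\}$ with $d\in\{5,6,7\}$, or $\{3,4,4,d\}$ with $d\in\{4,5\}$.
   Context: The degree of a vertex is the number of tiles (equivalently edges) meeting at it. The tiles need not be congruent. -}

module Defs where

open import Data.Nat using (ℕ; zero; suc; _+_; _*_; _≤_)
open import Data.Fin using (Fin)
open import Data.Fin.Properties using (_≟_)
open import Data.List using (List; []; _∷_; length; filter)
open import Data.List.Relation.Binary.Permutation.Propositional using (_↭_)
open import Data.Product using (Σ; ∃; ∃-syntax; _×_; _,_)
open import Data.Sum using (_⊎_)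
open import Data.List using (allFin) public
open import Relation.Binary.PropositionalEquality using (_≡_; _≢_)
open import Relation.Nullary using (¬_)

iter : {A : Set} → ℕ → (A → A) → A → A
iter zero    f x = x
iter (suc k) f x = f (iter k f x)

SameOrbit : {n : ℕ} → (Fin n → Fin n) → Fin n → Fin n → Set
SameOrbit f d d' = ∃[ k ] iter k f d ≡ d'

LabelsOrbits : {n m : ℕ} → (Fin n → Fin n) → (Fin n → Fin m) → Set
LabelsOrbits f lab =
  ((x : _) → ∃[ d ] lab d ≡ x) ×
  ((d d' : _) → (lab d ≡ lab d' → SameOrbit f d d') × (SameOrbit f d d' → lab d ≡ lab d'))

data Reach {n : ℕ} (σ α : Fin n → Fin n) (d : Fin n) : Fin n → Set where
  here  : Reach σ α d d
  viaσ  : ∀ {e} → Reach σ α d e → Reach σ α d (σ e)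
  viaα  : ∀ {e} → Reach σ α d e → Reach σ α d (α e)

-- A finite edge-to-edge tiling of the sphere by quadrilaterals, encoded as a
-- connected combinatorial map of genus 0 (a quadrangulation of the sphere).
-- Darts = Fin n; σ rotates darts around their vertex, α is the edge
-- involution, φ = σ ∘ α traverses tiles.
record QuadTiling : Set where
  field
    n V E F : ℕ
    σ σ⁻¹ α : Fin n → Fin n
    σ-inv₁  : ∀ d → σ⁻¹ (σ d) ≡ d
    σ-inv₂  : ∀ d → σ (σ⁻¹ d) ≡ d
    α-invol : ∀ d → α (α d) ≡ d
    α-free  : ∀ d → α d ≢ d
    vert : Fin n → Fin V
    edge : Fin n → Fin E
    face : Fin n → Fin F
  φ : Fin n → Fin n
  φ d = σ (α d)
  field
    vert-orbits : LabelsOrbits σ vert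
    edge-orbits : LabelsOrbits α edge
    face-orbits : LabelsOrbits φ face
    connected   : ∀ d d' → Reach σ α d d'
    -- genus 0 (sphere): Euler characteristic V - E + F = 2
    euler       : V + F ≡ E + 2
    face-size   : ∀ d → iter 4 φ d ≡ d
    corners-distinct :
      ∀ d → (vert d ≢ vert (φ d)) × (vert d ≢ vert (iter 2 φ d)) × (vert d ≢ vert (iter 3 φ d))
          × (vert (φ d) ≢ vert (iter 2 φ d)) × (vert (φ d) ≢ vert (iter 3 φ d))
          × (vert (iter 2 φ d) ≢ vert (iter 3 φ d))

  degree : Fin V → ℕ
  degree x = length (filter (λ d → vert d ≟ x) (allFin n))

  tileDegrees : Fin n → List ℕ
  tileDegrees d = degree (vert d) ∷ degree (vert (φ d)) ∷ degree (vert (iter 2 φ d))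
                ∷ degree (vert (iter 3 φ d)) ∷ []

AllowedPattern : ℕ → ℕ → ℕ → ℕ → Set
AllowedPattern a b c e =
    (a ≡ 3 × b ≡ 3 × c ≡ 3 × 3 ≤ e)
  ⊎ (a ≡ 3 × b ≡ 3 × c ≡ 4 × 4 ≤ e × e ≤ 11)
  ⊎ (a ≡ 3 × b ≡ 3 × c ≡ 5 × (e ≡ 5 ⊎ e ≡ 6 ⊎ e ≡ 7))
  ⊎ (a ≡ 3 × b ≡ 4 × c ≡ 4 × (e ≡ 4 ⊎ e ≡ 5))

AllowedMultiset : List ℕ → Set
AllowedMultiset xs = ∃[ a ] ∃[ b ] ∃[ c ] ∃[ e ] (xs ↭ (a ∷ b ∷ c ∷ e ∷ [])) × AllowedPattern a b c e

{-# OPTIONS --safe #-}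
-- Let each corner at a vertex of degree m weigh roughly 120/m (see weight), so that the corners
-- around every vertex weigh at least 120 in total.  A quadrangulation of the sphere has
-- V = F + 2 > F (from V + F = E + 2 and 4F = #corners = 2E), so the total weight, at least 120·V,
-- exceeds 120·F and some tile weighs more than 120.  Sorting its four degrees, a short case
-- analysis shows that only the listed multisets are that heavy.
module Submission where

open import Defs
open import Data.Nat using (_≤_)
open import Data.Product using (∃-syntax)

open import Data.Nat as ℕ
  using (ℕ; zero; suc; _+_; _*_; _<_; _<?_; _≤?_; z≤n; s≤s; z<s; NonZero; >-nonZero)
open import Data.Nat.Properties
open import Data.Nat.Tactic.RingSolver using (solve-∀)
open import Data.Nat.ListAction using () renaming (sum to sumˡ)
open import Data.Nat.ListAction.Properties using (sum-↭)
open import Data.Fin using (Fin; zero; suc; toℕ; join; splitAt; remQuot; combine)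
open import Data.Fin.Properties using (any?; injective⇒≤; splitAt-join; combine-remQuot)
  renaming (_≟_ to _≟ᶠ_)
open import Data.Fin.Patterns using (0F; 1F; 2F; 3F)
open import Data.Fin.Permutation using (Permutation′; permutation; _⟨$⟩ʳ_)
open import Data.List using (List; []; _∷_; length; filter; tabulate; map)
open import Data.List.Relation.Unary.All using (All; []; _∷_)
open import Data.List.Relation.Unary.Linked using (Linked; [-]; _∷_)
open import Data.List.Relation.Binary.Permutation.Propositional using (_↭_; ↭-refl; ↭-sym; ↭-trans)
open import Data.List.Relation.Binary.Permutation.Propositional.Properties
  using (map⁺; All-resp-↭; ↭-length)
import Data.List.Sort as Sort
open import Data.Product using (_,_; proj₁; proj₂; uncurry)
open import Data.Sum as Sum using (_⊎_; inj₁; inj₂)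
open import Data.Sum.Properties using (inj₁-injective; inj₂-injective)
open import Data.Bool using (if_then_else_)
open import Data.Empty using (⊥; ⊥-elim)
open import Function using (_∘_; id)
open import Function.Definitions using (Injective)
open import Relation.Nullary using (Dec; does; yes; no; ¬_)
open import Relation.Nullary.Decidable using (True; toWitness)
open import Relation.Unary using (Decidable)
open import Relation.Binary.PropositionalEquality
open import Algebra.Properties.Semiring.Sum +-*-semiring
  using (sum-syntax; ∑-comm; *-distribʳ-sum; sum-cong-≗; sum-permute; sum-replicate-zero)

private
  variable
    A : Set

⟦_⟧ : Dec A → ℕ
⟦ a? ⟧ = if does a? then 1 else 0

∑-mono-≤ : ∀ {n} {f g : Fin n → ℕ} → (∀ i → f i ≤ g i) → ∑[ i < n ] f i ≤ ∑[ i < n ] g i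
∑-mono-≤ {zero}  f≤g = z≤n
∑-mono-≤ {suc n} f≤g = +-mono-≤ (f≤g zero) (∑-mono-≤ (f≤g ∘ suc))

∑-const : ∀ n c → ∑[ i < n ] c ≡ n * c
∑-const zero    c = refl
∑-const (suc n) c = cong (c +_) (∑-const n c)

length-filter-tabulate : ∀ {n} {P : A → Set} (P? : Decidable P) (h : Fin n → A) →
  length (filter P? (tabulate h)) ≡ ∑[ i < n ] ⟦ P? (h i) ⟧
length-filter-tabulate {n = zero}  P? h = refl
length-filter-tabulate {n = suc n} P? h with P? (h zero)
... | yes _ = cong suc (length-filter-tabulate P? (h ∘ suc))
... | no  _ = length-filter-tabulate P? (h ∘ suc)

∑-⟦≟⟧ : ∀ {m} (x : Fin m) (g : Fin m → ℕ) → ∑[ y < m ] (⟦ x ≟ᶠ y ⟧ * g y) ≡ g x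
∑-⟦≟⟧ {suc m} zero    g =
  trans (cong₂ _+_ (+-identityʳ (g zero)) (sum-replicate-zero m)) (+-identityʳ (g zero))
∑-⟦≟⟧ {suc m} (suc x) g = ∑-⟦≟⟧ x (g ∘ suc)

fibreSize : ∀ {n m} → (Fin n → Fin m) → Fin m → ℕ
fibreSize {n} f y = length (filter (λ x → f x ≟ᶠ y) (allFin n))

∑-fibres : ∀ {n m} (f : Fin n → Fin m) (g : Fin m → ℕ) →
  ∑[ x < n ] g (f x) ≡ ∑[ y < m ] (fibreSize f y * g y)
∑-fibres {n} {m} f g = begin
  ∑[ x < n ] g (f x)                      ≡⟨ sum-cong-≗ (λ x → sym (∑-⟦≟⟧ (f x) g)) ⟩
  ∑[ x < n ] ∑[ y < m ] (δ x y * g y)     ≡⟨ ∑-comm (λ x y → δ x y * g y) ⟩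
  ∑[ y < m ] ∑[ x < n ] (δ x y * g y)     ≡⟨ sum-cong-≗ (λ y → sym (*-distribʳ-sum (g y) (λ x → δ x y))) ⟩
  ∑[ y < m ] ((∑[ x < n ] δ x y) * g y)   ≡⟨ sum-cong-≗ (λ y → cong (_* g y) (sym (fibreSize≡∑ y))) ⟩
  ∑[ y < m ] (fibreSize f y * g y)        ∎
  where
  open ≡-Reasoning

  δ : Fin n → Fin m → ℕ
  δ x y = ⟦ f x ≟ᶠ y ⟧

  fibreSize≡∑ : ∀ y → fibreSize f y ≡ ∑[ x < n ] δ x y
  fibreSize≡∑ y = length-filter-tabulate (λ x → f x ≟ᶠ y) id

join-injective : ∀ m n → Injective _≡_ _≡_ (join m n)
join-injective m n {i} {j} eq =
  trans (sym (splitAt-join m n i)) (trans (cong (splitAt m) eq) (splitAt-join m n j))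

remQuot-injective : ∀ {m} k → Injective _≡_ _≡_ (remQuot {m} k)
remQuot-injective {m} k {i} {j} eq =
  trans (sym (combine-remQuot {m} k i)) (trans (cong (uncurry combine) eq) (combine-remQuot {m} k j))

fibres-in-pairs⇒≤ : ∀ {n m} (f : Fin n → Fin m) (r s : Fin m → Fin n) →
  (∀ x → x ≡ r (f x) ⊎ x ≡ s (f x)) → n ≤ m + m
fibres-in-pairs⇒≤ {n} {m} f r s cover = injective⇒≤ tag-injective
  where
  side : ∀ x → x ≡ r (f x) ⊎ x ≡ s (f x) → Fin m ⊎ Fin m
  side x (inj₁ _) = inj₁ (f x)
  side x (inj₂ _) = inj₂ (f x)

  side-injective : ∀ {x x′} p q → side x p ≡ side x′ q → x ≡ x′
  side-injective (inj₁ x≡r) (inj₁ x′≡r) eq = trans x≡r (trans (cong r (inj₁-injective eq)) (sym x′≡r))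
  side-injective (inj₂ x≡s) (inj₂ x′≡s) eq = trans x≡s (trans (cong s (inj₂-injective eq)) (sym x′≡s))

  tag : Fin n → Fin (m + m)
  tag x = join m m (side x (cover x))

  tag-injective : Injective _≡_ _≡_ tag
  tag-injective {x} {x′} eq = side-injective (cover x) (cover x′) (join-injective m m eq)

injective-sections⇒*≤ : ∀ {n m k} (f : Fin n → Fin m) (c : Fin m → Fin k → Fin n) →
  (∀ y j → f (c y j) ≡ y) → (∀ y → Injective _≡_ _≡_ (c y)) → m * k ≤ n
injective-sections⇒*≤ {k = k} f c f∘c c-injective =
  injective⇒≤ (λ eq → remQuot-injective k (uncurry-c-injective eq))
  where
  uncurry-c-injective : Injective _≡_ _≡_ (uncurry c)
  uncurry-c-injective {y , j} {y′ , j′} eq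
    with refl ← trans (sym (f∘c y j)) (trans (cong f eq) (f∘c y′ j′)) = cong (y ,_) (c-injective y eq)

distinct₄⇒injective : (g : Fin 4 → A) →
  g 0F ≢ g 1F → g 0F ≢ g 2F → g 0F ≢ g 3F → g 1F ≢ g 2F → g 1F ≢ g 3F → g 2F ≢ g 3F →
  Injective _≡_ _≡_ g
distinct₄⇒injective g g₀₁ g₀₂ g₀₃ g₁₂ g₁₃ g₂₃ = injective
  where
  injective : Injective _≡_ _≡_ g
  injective {0F} {0F} _  = refl
  injective {1F} {1F} _  = refl
  injective {2F} {2F} _  = refl
  injective {3F} {3F} _  = refl
  injective {0F} {1F} eq = ⊥-elim (g₀₁ eq)
  injective {0F} {2F} eq = ⊥-elim (g₀₂ eq)
  injective {0F} {3F} eq = ⊥-elim (g₀₃ eq)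
  injective {1F} {2F} eq = ⊥-elim (g₁₂ eq)
  injective {1F} {3F} eq = ⊥-elim (g₁₃ eq)
  injective {2F} {3F} eq = ⊥-elim (g₂₃ eq)
  injective {1F} {0F} eq = ⊥-elim (g₀₁ (sym eq))
  injective {2F} {0F} eq = ⊥-elim (g₀₂ (sym eq))
  injective {3F} {0F} eq = ⊥-elim (g₀₃ (sym eq))
  injective {2F} {1F} eq = ⊥-elim (g₁₂ (sym eq))
  injective {3F} {1F} eq = ⊥-elim (g₁₃ (sym eq))
  injective {3F} {2F} eq = ⊥-elim (g₂₃ (sym eq))

iter-involutive : {f : A → A} → (∀ x → f (f x) ≡ x) → ∀ k x → iter k f x ≡ x ⊎ iter k f x ≡ f x
iter-involutive         f-invol zero    x = inj₁ refl
iter-involutive {f = f} f-invol (suc k) x with iter-involutive f-invol k x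
... | inj₁ fᵏx≡x  = inj₂ (cong f fᵏx≡x)
... | inj₂ fᵏx≡fx = inj₁ (trans (cong f fᵏx≡fx) (f-invol x))

∑-∘-iter : ∀ {n} (π : Permutation′ n) (g : Fin n → ℕ) (k : ℕ) →
  ∑[ x < n ] g (iter k (π ⟨$⟩ʳ_) x) ≡ ∑[ x < n ] g x
∑-∘-iter π g zero    = refl
∑-∘-iter π g (suc k) = trans (∑-∘-iter π (g ∘ (π ⟨$⟩ʳ_)) k) (sym (sum-permute g π))

module _ {n m} {f : Fin n → Fin n} {lab : Fin n → Fin m} (labels : LabelsOrbits f lab) where

  representative : Fin m → Fin n
  representative y = proj₁ (proj₁ labels y)

  label-representative : ∀ y → lab (representative y) ≡ y
  label-representative y = proj₂ (proj₁ labels y)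

  label-iter : ∀ k x → lab (iter k f x) ≡ lab x
  label-iter k x = sym (proj₂ (proj₂ labels x (iter k f x)) (k , refl))

  sameLabel⇒sameOrbit : ∀ {x x′} → lab x ≡ lab x′ → SameOrbit f x x′
  sameLabel⇒sameOrbit = proj₁ (proj₂ labels _ _)

euler-contradiction : ∀ {V E F n} → V + F ≡ E + 2 → 4 * V ≤ n → F * 4 ≤ n → n ≤ E + E → ⊥
euler-contradiction {V} {E} {F} {n} euler 4V≤n 4F≤n n≤2E = <-irrefl refl (begin-strict
  E + E + (E + E)      <⟨ m<m+n (E + E + (E + E)) {8} z<s ⟩
  E + E + (E + E) + 8  ≡⟨ 4*[x+2] E ⟨
  4 * (E + 2)          ≡⟨ cong (4 *_) euler ⟨
  4 * (V + F)          ≡⟨ *-distribˡ-+ 4 V F ⟩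
  4 * V + 4 * F        ≡⟨ cong (4 * V +_) (*-comm 4 F) ⟩
  4 * V + F * 4        ≤⟨ +-mono-≤ 4V≤n 4F≤n ⟩
  n + n                ≤⟨ +-mono-≤ n≤2E n≤2E ⟩
  E + E + (E + E)      ∎)
  where
  open ≤-Reasoning
  4*[x+2] : ∀ x → 4 * (x + 2) ≡ x + x + (x + x) + 8
  4*[x+2] = solve-∀

pattern 12+_ k = suc (suc (suc (suc (suc (suc (suc (suc (suc (suc (suc (suc k)))))))))))

≤-by-decision : {a b : ℕ} → True (a ≤? b) → a ≤ b
≤-by-decision {a} {b} = toWitness {a? = a ≤? b}

-- weight m = 120 / t for the largest t ∈ {1, 2, 3, 4, 5, 6, 8, 12} with t ≤ m (weight 0 is junk):
-- at least 120 / m, and exact at the thresholds of the case analysis in sorted-heavy⇒allowed.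
weight : ℕ → ℕ
weight 0  = 120
weight 1  = 120
weight 2  = 60
weight 3  = 40
weight 4  = 30
weight 5  = 24
weight 6  = 20
weight 7  = 20
weight 8  = 15
weight 9  = 15
weight 10 = 15
weight 11 = 15
weight _  = 10

weight-suc : ∀ m → weight (suc m) ≤ weight m
weight-suc 0       = ≤-by-decision _
weight-suc 1       = ≤-by-decision _
weight-suc 2       = ≤-by-decision _
weight-suc 3       = ≤-by-decision _
weight-suc 4       = ≤-by-decision _
weight-suc 5       = ≤-by-decision _
weight-suc 6       = ≤-by-decision _
weight-suc 7       = ≤-by-decision _
weight-suc 8       = ≤-by-decision _
weight-suc 9       = ≤-by-decision _
weight-suc 10      = ≤-by-decision _
weight-suc 11      = ≤-by-decision _
weight-suc (12+ k) = ≤-refl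

weight-antitone : ∀ {m m′} → m ≤ m′ → weight m′ ≤ weight m
weight-antitone m≤m′ = go (≤⇒≤′ m≤m′)
  where
  go : ∀ {m m′} → m ℕ.≤′ m′ → weight m′ ≤ weight m
  go ℕ.≤′-refl        = ≤-refl
  go (ℕ.≤′-step m≤′m′) = ≤-trans (weight-suc _) (go m≤′m′)

120≤*weight : ∀ m → .{{NonZero m}} → 120 ≤ m * weight m
120≤*weight 1       = ≤-by-decision _
120≤*weight 2       = ≤-by-decision _
120≤*weight 3       = ≤-by-decision _
120≤*weight 4       = ≤-by-decision _
120≤*weight 5       = ≤-by-decision _
120≤*weight 6       = ≤-by-decision _
120≤*weight 7       = ≤-by-decision _
120≤*weight 8       = ≤-by-decision _
120≤*weight 9       = ≤-by-decision _
120≤*weight 10      = ≤-by-decision _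
120≤*weight 11      = ≤-by-decision _
120≤*weight (12+ k) = m≤m+n 120 (k * 10)

load : List ℕ → ℕ
load xs = sumˡ (map weight xs)

Heavy : List ℕ → Set
Heavy xs = 120 < load xs

load-antitone : ∀ {a b c e a′ b′ c′ e′} → a′ ≤ a → b′ ≤ b → c′ ≤ c → e′ ≤ e →
  load (a ∷ b ∷ c ∷ e ∷ []) ≤ load (a′ ∷ b′ ∷ c′ ∷ e′ ∷ [])
load-antitone a′≤a b′≤b c′≤c e′≤e =
  +-mono-≤ (weight-antitone a′≤a) (+-mono-≤ (weight-antitone b′≤b)
    (+-mono-≤ (weight-antitone c′≤c) (+-monoˡ-≤ 0 (weight-antitone e′≤e))))

¬Heavy-beyond : ∀ a′ b′ c′ e′ {a b c e} → a′ ≤ a → b′ ≤ b → c′ ≤ c → e′ ≤ e →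
  {True (load (a′ ∷ b′ ∷ c′ ∷ e′ ∷ []) ≤? 120)} → ¬ Heavy (a ∷ b ∷ c ∷ e ∷ [])
¬Heavy-beyond a′ b′ c′ e′ a′≤a b′≤b c′≤c e′≤e {light} heavy =
  <⇒≱ heavy (≤-trans (load-antitone a′≤a b′≤b c′≤c e′≤e) (toWitness light))

m≤n≤1+m⇒n≡m∨n≡1+m : ∀ {m n} → m ≤ n → n ≤ suc m → n ≡ m ⊎ n ≡ suc m
m≤n≤1+m⇒n≡m∨n≡1+m m≤n n≤1+m with m≤n⇒m<n∨m≡n m≤n
... | inj₂ refl = inj₁ refl
... | inj₁ m<n  = inj₂ (≤-antisym n≤1+m m<n)

module _ {e : ℕ} where

  allowed-3-3-c : ∀ {c} → 3 ≤ c → c ≤ e → Heavy (3 ∷ 3 ∷ c ∷ e ∷ []) → AllowedPattern 3 3 c e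
  allowed-3-3-c 3≤c c≤e heavy with m≤n⇒m<n∨m≡n 3≤c
  ... | inj₂ refl = inj₁ (refl , refl , refl , c≤e)
  ... | inj₁ 4≤c with m≤n⇒m<n∨m≡n 4≤c
  ...   | inj₂ refl = inj₂ (inj₁ (refl , refl , refl , c≤e , e≤11))
    where e≤11 : e ≤ 11
          e≤11 = ≮⇒≥ (λ 12≤e → ¬Heavy-beyond 3 3 4 12 ≤-refl ≤-refl ≤-refl 12≤e heavy)
  ...   | inj₁ 5≤c with m≤n⇒m<n∨m≡n 5≤c
  ...     | inj₁ 6≤c  = ⊥-elim (¬Heavy-beyond 3 3 6 6 ≤-refl ≤-refl 6≤c (≤-trans 6≤c c≤e) heavy)
  ...     | inj₂ refl with m≤n⇒m<n∨m≡n c≤e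
  ...       | inj₂ refl = inj₂ (inj₂ (inj₁ (refl , refl , refl , inj₁ refl)))
  ...       | inj₁ 6≤e  =
    inj₂ (inj₂ (inj₁ (refl , refl , refl , inj₂ (m≤n≤1+m⇒n≡m∨n≡1+m 6≤e e≤7))))
    where e≤7 : e ≤ 7
          e≤7 = ≮⇒≥ (λ 8≤e → ¬Heavy-beyond 3 3 5 8 ≤-refl ≤-refl ≤-refl 8≤e heavy)

  allowed-3-4-c : ∀ {c} → 4 ≤ c → c ≤ e → Heavy (3 ∷ 4 ∷ c ∷ e ∷ []) → AllowedPattern 3 4 c e
  allowed-3-4-c 4≤c c≤e heavy with m≤n⇒m<n∨m≡n 4≤c
  ... | inj₁ 5≤c  = ⊥-elim (¬Heavy-beyond 3 4 5 5 ≤-refl ≤-refl 5≤c (≤-trans 5≤c c≤e) heavy)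
  ... | inj₂ refl = inj₂ (inj₂ (inj₂ (refl , refl , refl , m≤n≤1+m⇒n≡m∨n≡1+m c≤e e≤5)))
    where e≤5 : e ≤ 5
          e≤5 = ≮⇒≥ (λ 6≤e → ¬Heavy-beyond 3 4 4 6 ≤-refl ≤-refl ≤-refl 6≤e heavy)

  sorted-heavy⇒allowed : ∀ {a b c} → 3 ≤ a → a ≤ b → b ≤ c → c ≤ e →
    Heavy (a ∷ b ∷ c ∷ e ∷ []) → AllowedPattern a b c e
  sorted-heavy⇒allowed {a} {b} {c} 3≤a a≤b b≤c c≤e heavy with m≤n⇒m<n∨m≡n 3≤a
  ... | inj₁ 4≤a = ⊥-elim (¬Heavy-beyond 4 4 4 4 4≤a 4≤b 4≤c (≤-trans 4≤c c≤e) heavy)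
    where 4≤b : 4 ≤ b
          4≤b = ≤-trans 4≤a a≤b
          4≤c : 4 ≤ c
          4≤c = ≤-trans 4≤b b≤c
  ... | inj₂ refl with m≤n⇒m<n∨m≡n a≤b
  ...   | inj₂ refl = allowed-3-3-c b≤c c≤e heavy
  ...   | inj₁ 4≤b with m≤n⇒m<n∨m≡n 4≤b
  ...     | inj₂ refl = allowed-3-4-c b≤c c≤e heavy
  ...     | inj₁ 5≤b  = ⊥-elim (¬Heavy-beyond 3 5 5 5 ≤-refl 5≤b 5≤c (≤-trans 5≤c c≤e) heavy)
    where 5≤c : 5 ≤ c
          5≤c = ≤-trans 5≤b b≤c

open Sort ≤-decTotalOrder using (sort; sort-↭; sort-↗)

allowedMultiset-↭ : ∀ {xs ys} → xs ↭ ys → AllowedMultiset ys → AllowedMultiset xs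
allowedMultiset-↭ xs↭ys (a , b , c , e , ys↭abce , allowed) =
  a , b , c , e , ↭-trans xs↭ys ys↭abce , allowed

sorted-heavy⇒allowedMultiset : ∀ {ys} → Linked _≤_ ys → All (3 ≤_) ys → length ys ≡ 4 →
  Heavy ys → AllowedMultiset ys
sorted-heavy⇒allowedMultiset {a ∷ b ∷ c ∷ e ∷ []} (a≤b ∷ b≤c ∷ c≤e ∷ [-]) (3≤a ∷ _) _ heavy =
  a , b , c , e , ↭-refl , sorted-heavy⇒allowed 3≤a a≤b b≤c c≤e heavy
sorted-heavy⇒allowedMultiset {[]}                    _ _ () _
sorted-heavy⇒allowedMultiset {_ ∷ []}                _ _ () _
sorted-heavy⇒allowedMultiset {_ ∷ _ ∷ []}            _ _ () _
sorted-heavy⇒allowedMultiset {_ ∷ _ ∷ _ ∷ []}        _ _ () _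
sorted-heavy⇒allowedMultiset {_ ∷ _ ∷ _ ∷ _ ∷ _ ∷ _} _ _ () _

heavy⇒allowedMultiset : ∀ {xs} → All (3 ≤_) xs → length xs ≡ 4 → Heavy xs → AllowedMultiset xs
heavy⇒allowedMultiset {xs} 3≤xs length≡4 heavy = allowedMultiset-↭ (↭-sym sort↭xs)
  (sorted-heavy⇒allowedMultiset (sort-↗ xs) (All-resp-↭ (↭-sym sort↭xs) 3≤xs)
    (trans (↭-length sort↭xs) length≡4) (subst (120 <_) (sym (sum-↭ (map⁺ weight sort↭xs))) heavy))
  where
  sort↭xs : sort xs ↭ xs
  sort↭xs = sort-↭ xs

module _ (T : QuadTiling) where
  open QuadTiling T

  φ-permutation : Permutation′ n
  φ-permutation = permutation φ (α ∘ σ⁻¹)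
    (λ d → trans (cong σ (α-invol (σ⁻¹ d))) (σ-inv₂ d))
    (λ d → trans (cong α (σ-inv₁ (α d))) (α-invol d))

  darts≤2*edges : n ≤ E + E
  darts≤2*edges = fibres-in-pairs⇒≤ edge r (α ∘ r) endpoint
    where
    r : Fin E → Fin n
    r = representative edge-orbits

    endpoint : ∀ d → d ≡ r (edge d) ⊎ d ≡ α (r (edge d))
    endpoint d with k , αᵏr≡d ← sameLabel⇒sameOrbit edge-orbits (label-representative edge-orbits (edge d)) =
      Sum.map (trans (sym αᵏr≡d)) (trans (sym αᵏr≡d)) (iter-involutive α-invol k (r (edge d)))

  corner : Fin F → Fin 4 → Fin n
  corner y j = iter (toℕ j) φ (representative face-orbits y)

  4*faces≤darts : F * 4 ≤ n
  4*faces≤darts = injective-sections⇒*≤ face corner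
    (λ y j → trans (label-iter face-orbits (toℕ j) _) (label-representative face-orbits y))
    corner-injective
    where
    corner-injective : ∀ y → Injective _≡_ _≡_ (corner y)
    corner-injective y eq
      with v₀₁ , v₀₂ , v₀₃ , v₁₂ , v₁₃ , v₂₃ ← corners-distinct (representative face-orbits y) =
      distinct₄⇒injective (vert ∘ corner y) v₀₁ v₀₂ v₀₃ v₁₂ v₁₃ v₂₃ (cong vert eq)

  cornerWeight : Fin n → ℕ
  cornerWeight d = weight (degree (vert d))

  ∑-load : ∑[ d < n ] load (tileDegrees d) ≡ 4 * ∑[ d < n ] cornerWeight d
  ∑-load = begin
    ∑[ d < n ] load (tileDegrees d)                        ≡⟨⟩
    ∑[ d < n ] ∑[ j < 4 ] cornerWeight (iter (toℕ j) φ d)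
      ≡⟨ ∑-comm {n} {4} (λ d j → cornerWeight (iter (toℕ j) φ d)) ⟩
    ∑[ j < 4 ] ∑[ d < n ] cornerWeight (iter (toℕ j) φ d)
      ≡⟨ sum-cong-≗ {4} (λ j → ∑-∘-iter φ-permutation cornerWeight (toℕ j)) ⟩
    ∑[ j < 4 ] ∑[ d < n ] cornerWeight d                   ≡⟨ ∑-const 4 (∑[ d < n ] cornerWeight d) ⟩
    4 * ∑[ d < n ] cornerWeight d                          ∎
    where open ≡-Reasoning

  ∑-cornerWeight≥ : (∀ x → 3 ≤ degree x) → V * 120 ≤ ∑[ d < n ] cornerWeight d
  ∑-cornerWeight≥ deg≥3 = begin
    V * 120                                     ≡⟨ ∑-const V 120 ⟨
    ∑[ x < V ] 120                              ≤⟨ ∑-mono-≤ (λ x → 120≤*weight (degree x) {{degree≢0 x}}) ⟩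
    ∑[ x < V ] (degree x * weight (degree x))   ≡⟨ ∑-fibres vert (weight ∘ degree) ⟨
    ∑[ d < n ] cornerWeight d                   ∎
    where
    open ≤-Reasoning

    degree≢0 : ∀ x → NonZero (degree x)
    degree≢0 x = >-nonZero (≤-trans (s≤s z≤n) (deg≥3 x))

  light⇒4*vertices≤darts : (∀ x → 3 ≤ degree x) → (∀ d → ¬ Heavy (tileDegrees d)) → 4 * V ≤ n
  light⇒4*vertices≤darts deg≥3 light = *-cancelʳ-≤ (4 * V) n 120 (begin
    4 * V * 120                          ≡⟨ *-assoc 4 V 120 ⟩
    4 * (V * 120)                        ≤⟨ *-monoʳ-≤ 4 (∑-cornerWeight≥ deg≥3) ⟩
    4 * ∑[ d < n ] cornerWeight d        ≡⟨ ∑-load ⟨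
    ∑[ d < n ] load (tileDegrees d)      ≤⟨ ∑-mono-≤ (λ d → ≮⇒≥ (light d)) ⟩
    ∑[ d < n ] 120                       ≡⟨ ∑-const n 120 ⟩
    n * 120                              ∎)
    where open ≤-Reasoning

  some-tile-heavy : (∀ x → 3 ≤ degree x) → ∃[ d ] Heavy (tileDegrees d)
  some-tile-heavy deg≥3 with any? (λ d → 120 <? load (tileDegrees d))
  ... | yes heavy-tile = heavy-tile
  ... | no  no-heavy   = ⊥-elim (euler-contradiction {V} {E} {F} euler
          (light⇒4*vertices≤darts deg≥3 (λ d heavy → no-heavy (d , heavy))) 4*faces≤darts darts≤2*edges)

lemma2p1 : (T : QuadTiling) → (∀ x → 3 ≤ QuadTiling.degree T x) →
           ∃[ d ] AllowedMultiset (QuadTiling.tileDegrees T d)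
lemma2p1 T deg≥3 =
  let d , heavy = some-tile-heavy T deg≥3 in
  d , heavy⇒allowedMultiset (deg≥3 _ ∷ deg≥3 _ ∷ deg≥3 _ ∷ deg≥3 _ ∷ []) refl heavy
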